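{- Let $A_1,\dots,A_N$ be symmetric $N\times N$ matrices over $\mathbb{F}_2$ with $(A_i)_{k,k}=\delta_{ik}$ for all $i,k$, let $A(z)=\sum_{i=1}^Nz(i)A_i$, and let $C$ be any fixed symmetric $N\times N$ matrix over $\mathbb{F}_2$. Then for every $1\le k\le N$, with $z$ uniform in $\mathbb{F}_2^N$, $$\Pr_z\big\{\operatorname{rank}(A(z)+C)\le k-1\big\}\le\frac{1}{2^N}\sum_{i=0}^{k-1}{N\choose i}.$$ -}

module Defs where

open import Data.Bool using (Bool; true; false; _xor_; _∧_; not; if_then_else_)
open import Data.Nat using (ℕ; zero; suc; _⊔_)
open import Data.Fin using (Fin; zero; suc)
open import Data.Vec using (Vec; []; _∷_; lookup)
open import Data.List using (List; []; _∷_; map; _++_; foldr)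
open import Data.Fin.Subset using (Subset; ∣_∣)

-- The field F₂ is modelled by Bool: addition is xor, multiplication is ∧.
F₂ : Set
F₂ = Bool

Mat : ℕ → Set
Mat N = Fin N → Fin N → F₂

Σ₂ : ∀ {n} → (Fin n → F₂) → F₂
Σ₂ {zero}  f = false
Σ₂ {suc n} f = f zero xor Σ₂ (λ i → f (suc i))

Symmetric : ∀ {N} → Mat N → Set
Symmetric A = ∀ i j → A i j ≡ A j i
  where open import Relation.Binary.PropositionalEquality using (_≡_)

δ : ∀ {N} → Fin N → Fin N → F₂
δ zero    zero    = true
δ zero    (suc _) = false
δ (suc _) zero    = false
δ (suc i) (suc j) = δ i j

_+ₘ_ : ∀ {N} → Mat N → Mat N → Mat N
(A +ₘ B) i j = A i j xor B i j

lincomb : ∀ {N} → (Fin N → Mat N) → Vec F₂ N → Mat N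
lincomb As z a b = Σ₂ (λ i → lookup z i ∧ As i a b)

-- All vectors in F₂ⁿ (equivalently all subsets of Fin n), each listed once.
allVecs : (n : ℕ) → List (Vec F₂ n)
allVecs zero    = [] ∷ []
allVecs (suc n) = map (false ∷_) (allVecs n) ++ map (true ∷_) (allVecs n)

-- Rank over F₂ as the maximal number of linearly independent rows.
-- Over F₂ a linear combination of rows is a sum of a subset T of rows.
rowSum : ∀ {N} → Mat N → Subset N → Fin N → F₂
rowSum A T j = Σ₂ (λ i → lookup T i ∧ A i j)

isZeroVec : ∀ {N} → (Fin N → F₂) → Bool
isZeroVec {zero}  v = true
isZeroVec {suc N} v = not (v zero) ∧ isZeroVec (λ i → v (suc i))

isEmpty : ∀ {n} → Subset n → Bool
isEmpty []       = true
isEmpty (x ∷ xs) = not x ∧ isEmpty xs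

_⊆ᵇ_ : ∀ {n} → Subset n → Subset n → Bool
[]       ⊆ᵇ []       = true
(x ∷ xs) ⊆ᵇ (y ∷ ys) = (not x ∨' y) ∧ (xs ⊆ᵇ ys)
  where
  _∨'_ : Bool → Bool → Bool
  true ∨' _ = true
  false ∨' b = b

allᵇ : {A : Set} → (A → Bool) → List A → Bool
allᵇ p = foldr (λ x b → p x ∧ b) true

independentᵇ : ∀ {N} → Mat N → Subset N → Bool
independentᵇ {N} A S =
  allᵇ (λ T → not ((T ⊆ᵇ S) ∧ not (isEmpty T) ∧ isZeroVec (rowSum A T))) (allVecs N)

rank : ∀ {N} → Mat N → ℕ
rank {N} A = foldr (λ S r → (if independentᵇ A S then ∣ S ∣ else 0) ⊔ r) 0 (allVecs N)

-- The proof is the polynomial method.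
--  * det M S, the principal minor of a symmetric M on S, admits cofactor
--    expansion at every index (det-expands).  It is invariant under the
--    congruences that add one row and column to another (det-addRowCol), so it
--    vanishes when the rows of S are dependent (det-dependent); hence
--    ∣ S ∣ ≤ rank M whenever det M S = 1 (rank-≥).
--  * As the entries of A(z) + C are affine in z and its diagonal is z + diag C,
--    det (A(z) + C) S = z^S + (terms of lower degree) (LeadingTerm.leading).
--  * On the set Z of low-rank points all minors of size ≥ k vanish, so every
--    monomial, and by interpolation every function, agrees on Z with a
--    polynomial of degree < k (low-degree-on).
--  * The coefficient vectors of such polynomials therefore map onto the value
--    vectors on Z (dimension-bound), and there are Σ_{i<k} C(N, i) monomials
--    of degree < k (count-small).

module Submission where

open import Defs
open import Data.Bool using (Bool; true; false; _xor_; _∧_; not; if_then_else_)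
open import Data.Bool.Properties
  using ( _≟_; xor-∧-commutativeRing; xor-same; xor-assoc; xor-identityʳ
        ; ∧-comm; ∧-assoc; ∧-zeroʳ; ∧-identityʳ; ∧-conicalˡ; ∧-conicalʳ )
open import Data.Empty using (⊥-elim)
open import Data.Fin using (Fin; zero; suc)
open import Data.Fin.Subset using (Subset; ∣_∣; ⊥; ⁅_⁆; _∪_)
open import Data.Fin.Subset.Properties using (∣⁅x⁆∣≡1; ∣⊥∣≡0)
open import Data.List using (List; []; _∷_; map; _++_; foldr; length; filter; applyUpTo; upTo)
open import Data.List.Properties using (length-++; length-map; length-removeAt′; filter-++; map-upTo)
open import Data.List.Membership.Propositional using (_∈_)
open import Data.List.Membership.Propositional.Properties
  using (∈-map⁺; ∈-map⁻; ∈-++⁺ˡ; ∈-++⁺ʳ; ∈-filter⁺; ∈-filter⁻)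
open import Data.List.Relation.Unary.All as All using (All; []; _∷_)
import Data.List.Relation.Unary.All.Properties as All
open import Data.List.Relation.Unary.AllPairs using ([]; _∷_)
open import Data.List.Relation.Unary.Any as Any using (here; there; index)
open import Data.List.Relation.Unary.Unique.Propositional using (Unique)
import Data.List.Relation.Unary.Unique.Propositional.Properties as Unique
open import Data.Maybe using (nothing)
open import Data.Nat using (ℕ; zero; suc; _≤_; _<_; _+_; _∸_; _^_; _⊔_; s≤s; s≤s⁻¹; z≤n)
open import Data.Nat.Combinatorics using (_C_; nCk+nC[k+1]≡[n+1]C[k+1])
open import Data.Nat.Induction using (<-wellFounded)
open import Data.Nat.ListAction using (sum)
open import Data.Nat.Properties
  using ( _≤?_; _<?_; module ≤-Reasoning; ≤-refl; ≤-reflexive; ≤-trans; <-irrefl; <⇒≤; ≮⇒≥; ≤⇒≯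
        ; n≤1+n; m≤m⊔n; m≤n⊔m; +-suc; +-comm; +-identityʳ; +-mono-≤; +-monoʳ-≤; ^-monoʳ-< )
open import Data.Nat.Tactic.RingSolver using () renaming (solve-∀ to ℕ-solve-∀)
open import Data.Product using (Σ; _,_; _×_; proj₁; proj₂)
open import Data.Sum using (_⊎_; inj₁; inj₂)
open import Data.Unit using (⊤)
open import Data.Vec using (Vec; []; _∷_; lookup; replicate)
open import Data.Vec.Properties using (lookup-replicate; ∷-injectiveʳ; ≡-dec)
open import Function using (_∘_)
import Induction.WellFounded as WF
import Relation.Binary.Construct.On as On
open import Relation.Binary.PropositionalEquality
open import Relation.Nullary using (¬_; Dec; contradiction; yes; no; does)
open import Relation.Unary using (Decidable)
open import Tactic.RingSolver using (solve-∀)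
open import Tactic.RingSolver.Core.AlmostCommutativeRing using (AlmostCommutativeRing; fromCommutativeRing)

-- F₂ as a commutative ring, for the ring solver (identities valid in every
-- commutative ring; facts specific to characteristic 2 are proved by hand).
F₂-ring : AlmostCommutativeRing _ _
F₂-ring = fromCommutativeRing xor-∧-commutativeRing (λ _ → nothing)

xor-cancelˡ : ∀ x y → x xor (x xor y) ≡ y
xor-cancelˡ x y = trans (sym (xor-assoc x x y)) (cong (_xor y) (xor-same x))

Σ₂-cong : ∀ {n} {f g : Fin n → F₂} → (∀ i → f i ≡ g i) → Σ₂ f ≡ Σ₂ g
Σ₂-cong {zero}  eq = refl
Σ₂-cong {suc n} eq = cong₂ _xor_ (eq zero) (Σ₂-cong (eq ∘ suc))

Σ₂-zero : ∀ {n} {f : Fin n → F₂} → (∀ i → f i ≡ false) → Σ₂ f ≡ false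
Σ₂-zero {zero}  eq = refl
Σ₂-zero {suc n} eq rewrite eq zero = Σ₂-zero (eq ∘ suc)

Σ₂-xor : ∀ {n} (f g : Fin n → F₂) → Σ₂ (λ i → f i xor g i) ≡ Σ₂ f xor Σ₂ g
Σ₂-xor {zero}  f g = refl
Σ₂-xor {suc n} f g =
  trans (cong ((f zero xor g zero) xor_) (Σ₂-xor (f ∘ suc) (g ∘ suc)))
        (interchange (f zero) (g zero) (Σ₂ (f ∘ suc)) (Σ₂ (g ∘ suc)))
  where
  interchange : ∀ a b c d → (a xor b) xor (c xor d) ≡ (a xor c) xor (b xor d)
  interchange = solve-∀ F₂-ring

Σ₂-∧ˡ : ∀ {n} x (f : Fin n → F₂) → x ∧ Σ₂ f ≡ Σ₂ (λ i → x ∧ f i)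
Σ₂-∧ˡ {zero}  x f = ∧-zeroʳ x
Σ₂-∧ˡ {suc n} x f =
  trans (distrib x (f zero) (Σ₂ (f ∘ suc))) (cong ((x ∧ f zero) xor_) (Σ₂-∧ˡ x (f ∘ suc)))
  where
  distrib : ∀ x a b → x ∧ (a xor b) ≡ (x ∧ a) xor (x ∧ b)
  distrib = solve-∀ F₂-ring

Σ₂-∧ʳ : ∀ {n} (f : Fin n → F₂) x → Σ₂ f ∧ x ≡ Σ₂ (λ i → f i ∧ x)
Σ₂-∧ʳ f x = trans (∧-comm (Σ₂ f) x) (trans (Σ₂-∧ˡ x f) (Σ₂-cong (λ i → ∧-comm x (f i))))

Σ₂-swap : ∀ {n m} (g : Fin n → Fin m → F₂) →
  Σ₂ (λ i → Σ₂ (λ j → g i j)) ≡ Σ₂ (λ j → Σ₂ (λ i → g i j))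
Σ₂-swap {zero} {m} g = sym (Σ₂-zero {m} (λ _ → refl))
Σ₂-swap {suc n} g =
  trans (cong (Σ₂ (g zero) xor_) (Σ₂-swap (g ∘ suc)))
        (sym (Σ₂-xor (g zero) (λ j → Σ₂ (λ i → g (suc i) j))))

-- A symmetric double sum with vanishing diagonal is zero: the terms (i,j)
-- and (j,i) cancel.
Σ₂-symmetric : ∀ {n} (g : Fin n → Fin n → F₂) →
  (∀ i j → g i j ≡ g j i) → (∀ i → g i i ≡ false) → Σ₂ (λ i → Σ₂ (λ j → g i j)) ≡ false
Σ₂-symmetric {zero}  g sym-g diag-g = refl
Σ₂-symmetric {suc n} g sym-g diag-g =
  begin
    (g zero zero xor row) xor Σ₂ (λ i → g (suc i) zero xor Σ₂ (λ j → g (suc i) (suc j)))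
  ≡⟨ cong₂ (λ d s → (d xor row) xor s) (diag-g zero) (Σ₂-xor (λ i → g (suc i) zero) _) ⟩
    row xor (Σ₂ (λ i → g (suc i) zero) xor Σ₂ (λ i → Σ₂ (λ j → g (suc i) (suc j))))
  ≡⟨ cong₂ (λ c s → row xor (c xor s)) (Σ₂-cong (λ i → sym-g (suc i) zero))
       (Σ₂-symmetric (λ i j → g (suc i) (suc j)) (λ i j → sym-g (suc i) (suc j)) (diag-g ∘ suc)) ⟩
    row xor (row xor false)
  ≡⟨ xor-cancelˡ row false ⟩
    false
  ∎
  where
  open ≡-Reasoning
  row = Σ₂ (λ j → g zero (suc j))

Σ₂-δ : ∀ {n} (v : Vec F₂ n) a → Σ₂ (λ i → lookup v i ∧ δ i a) ≡ lookup v a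
Σ₂-δ (x ∷ v) zero =
  trans (cong₂ _xor_ (∧-identityʳ x) (Σ₂-zero (λ i → ∧-zeroʳ (lookup v i)))) (xor-identityʳ x)
Σ₂-δ (x ∷ v) (suc a) = trans (cong (_xor Σ₂ (λ i → lookup v i ∧ δ i a)) (∧-zeroʳ x)) (Σ₂-δ v a)

infix 4 _∈ₛ_
_∈ₛ_ : ∀ {n} → Fin n → Subset n → Set
i ∈ₛ S = lookup S i ≡ true

infixl 6 _∖_
_∖_ : ∀ {n} → Subset n → Fin n → Subset n
(x ∷ S) ∖ zero  = false ∷ S
(x ∷ S) ∖ suc a = x ∷ (S ∖ a)

δ-refl : ∀ {n} (i : Fin n) → δ i i ≡ true
δ-refl zero    = refl
δ-refl (suc i) = δ-refl i

∖-comm : ∀ {n} (S : Subset n) a b → S ∖ a ∖ b ≡ S ∖ b ∖ a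
∖-comm (x ∷ S) zero    zero    = refl
∖-comm (x ∷ S) zero    (suc b) = refl
∖-comm (x ∷ S) (suc a) zero    = refl
∖-comm (x ∷ S) (suc a) (suc b) = cong (x ∷_) (∖-comm S a b)

∖-removes : ∀ {n} (S : Subset n) a → lookup (S ∖ a) a ≡ false
∖-removes (x ∷ S) zero    = refl
∖-removes (x ∷ S) (suc a) = ∖-removes S a

∖-⊆ : ∀ {n} (S : Subset n) a i → i ∈ₛ S ∖ a → i ∈ₛ S
∖-⊆ (x ∷ S) zero    (suc i) i∈ = i∈
∖-⊆ (x ∷ S) (suc a) zero    i∈ = i∈
∖-⊆ (x ∷ S) (suc a) (suc i) i∈ = ∖-⊆ S a i i∈

∖-≢ : ∀ {n} (S : Subset n) a i → i ∈ₛ S ∖ a → δ i a ≡ false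
∖-≢ (x ∷ S) zero    (suc i) i∈ = refl
∖-≢ (x ∷ S) (suc a) zero    i∈ = refl
∖-≢ (x ∷ S) (suc a) (suc i) i∈ = ∖-≢ S a i i∈

∖-keeps : ∀ {n} (S : Subset n) a i → i ∈ₛ S → δ i a ≡ false → i ∈ₛ S ∖ a
∖-keeps (x ∷ S) zero    (suc i) i∈ i≢a = i∈
∖-keeps (x ∷ S) (suc a) zero    i∈ i≢a = i∈
∖-keeps (x ∷ S) (suc a) (suc i) i∈ i≢a = ∖-keeps S a i i∈ i≢a

∖-pair-sym : ∀ {n} (S : Subset n) a b → lookup S a ∧ lookup (S ∖ a) b ≡ lookup S b ∧ lookup (S ∖ b) a
∖-pair-sym (x ∷ S) zero    zero    = refl
∖-pair-sym (x ∷ S) zero    (suc b) = ∧-comm x (lookup S b)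
∖-pair-sym (x ∷ S) (suc a) zero    = ∧-comm (lookup S a) x
∖-pair-sym (x ∷ S) (suc a) (suc b) = ∖-pair-sym S a b

∈-∖-swap : ∀ {n} (S : Subset n) a b → a ∈ₛ S → b ∈ₛ S ∖ a → a ∈ₛ S ∖ b
∈-∖-swap S a b a∈ b∈ =
  ∧-conicalʳ (lookup S b) _ (trans (sym (∖-pair-sym S a b)) (cong₂ _∧_ a∈ b∈))

∣∖∣ : ∀ {n} (S : Subset n) a → a ∈ₛ S → suc ∣ S ∖ a ∣ ≡ ∣ S ∣
∣∖∣ (true  ∷ S) zero    refl = refl
∣∖∣ (false ∷ S) (suc a) a∈   = ∣∖∣ S a a∈
∣∖∣ (true  ∷ S) (suc a) a∈   = cong suc (∣∖∣ S a a∈)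

member-or-empty : ∀ {n} (S : Subset n) → (Σ (Fin n) (_∈ₛ S)) ⊎ (∀ i → lookup S i ≡ false)
member-or-empty []          = inj₂ (λ ())
member-or-empty (true  ∷ S) = inj₁ (zero , refl)
member-or-empty (false ∷ S) with member-or-empty S
... | inj₁ (a , a∈) = inj₁ (suc a , a∈)
... | inj₂ empty    = inj₂ λ { zero → refl ; (suc i) → empty i }

Σ∈-cong : ∀ {n} (S : Subset n) {f g : Fin n → F₂} → (∀ i → i ∈ₛ S → f i ≡ g i) →
  Σ₂ (λ i → lookup S i ∧ f i) ≡ Σ₂ (λ i → lookup S i ∧ g i)
Σ∈-cong S {f} {g} eq = Σ₂-cong pointwise
  where
  pointwise : ∀ i → lookup S i ∧ f i ≡ lookup S i ∧ g i
  pointwise i with lookup S i in i∈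
  ... | false = refl
  ... | true  = eq i i∈

Σ∈-split : ∀ {n} (S : Subset n) a (f : Fin n → F₂) → a ∈ₛ S →
  Σ₂ (λ b → lookup S b ∧ f b) ≡ f a xor Σ₂ (λ b → lookup (S ∖ a) b ∧ f b)
Σ∈-split (true ∷ S) zero    f refl = refl
Σ∈-split (x    ∷ S) (suc a) f a∈   =
  trans (cong ((x ∧ f zero) xor_) (Σ∈-split S a (f ∘ suc) a∈))
        (exchange (x ∧ f zero) (f (suc a)) _)
  where
  exchange : ∀ u v w → u xor (v xor w) ≡ v xor (u xor w)
  exchange = solve-∀ F₂-ring

expand : ∀ {n} → (Fin n → F₂) → (Subset n → F₂) → Subset n → F₂
expand r f W = Σ₂ (λ b → lookup W b ∧ (r b ∧ f (W ∖ b)))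

expand-cong : ∀ {n} (W : Subset n) {r r′ : Fin n → F₂} {f g : Subset n → F₂} →
  (∀ b → b ∈ₛ W → r b ≡ r′ b) → (∀ b → b ∈ₛ W → f (W ∖ b) ≡ g (W ∖ b)) →
  expand r f W ≡ expand r′ g W
expand-cong W r≡r′ f≡g = Σ∈-cong W (λ b b∈ → cong₂ _∧_ (r≡r′ b b∈) (f≡g b b∈))

expand-xorʳ : ∀ {n} (r r′ : Fin n → F₂) (f : Subset n → F₂) W →
  expand (λ b → r b xor r′ b) f W ≡ expand r f W xor expand r′ f W
expand-xorʳ {n} r r′ f W =
  trans (Σ₂-cong (λ b → distrib (lookup W b) (r b) (r′ b) (f (W ∖ b)))) (Σ₂-xor {n} _ _)
  where
  distrib : ∀ w x y d → w ∧ ((x xor y) ∧ d) ≡ (w ∧ (x ∧ d)) xor (w ∧ (y ∧ d))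
  distrib = solve-∀ F₂-ring

expand-xor : ∀ {n} (r : Fin n → F₂) (f g : Subset n → F₂) W →
  expand r (λ X → f X xor g X) W ≡ expand r f W xor expand r g W
expand-xor {n} r f g W =
  trans (Σ₂-cong (λ b → distrib (lookup W b) (r b) (f (W ∖ b)) (g (W ∖ b)))) (Σ₂-xor {n} _ _)
  where
  distrib : ∀ w x u v → w ∧ (x ∧ (u xor v)) ≡ (w ∧ (x ∧ u)) xor (w ∧ (x ∧ v))
  distrib = solve-∀ F₂-ring

expand-∧ : ∀ {n} (r : Fin n → F₂) c (f : Subset n → F₂) W →
  expand r (λ X → c ∧ f X) W ≡ c ∧ expand r f W
expand-∧ {n} r c f W =
  trans (Σ₂-cong (λ b → exchange (lookup W b) (r b) c (f (W ∖ b)))) (sym (Σ₂-∧ˡ {n} c _))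
  where
  exchange : ∀ w x c d → w ∧ (x ∧ (c ∧ d)) ≡ c ∧ (w ∧ (x ∧ d))
  exchange = solve-∀ F₂-ring

expand-split : ∀ {n} (r : Fin n → F₂) (f : Subset n → F₂) W a → a ∈ₛ W →
  expand r f W ≡ (r a ∧ f (W ∖ a)) xor Σ₂ (λ b → lookup (W ∖ a) b ∧ (r b ∧ f (W ∖ b)))
expand-split r f W a a∈ = Σ∈-split W a (λ b → r b ∧ f (W ∖ b)) a∈

pairTerm : ∀ {n} → (Fin n → F₂) → (Fin n → F₂) → (Subset n → F₂) → Subset n →
  Fin n → Fin n → F₂
pairTerm x y f W b c = lookup W b ∧ (x b ∧ (lookup (W ∖ b) c ∧ (y c ∧ f (W ∖ b ∖ c))))

expand²-as-Σ₂ : ∀ {n} (x y : Fin n → F₂) (f : Subset n → F₂) W →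
  expand x (expand y f) W ≡ Σ₂ (λ b → Σ₂ (λ c → pairTerm x y f W b c))
expand²-as-Σ₂ x y f W = Σ₂-cong (λ b → trans
  (cong (lookup W b ∧_) (Σ₂-∧ˡ (x b) (λ c → lookup (W ∖ b) c ∧ (y c ∧ f (W ∖ b ∖ c)))))
  (Σ₂-∧ˡ (lookup W b) (λ c → x b ∧ (lookup (W ∖ b) c ∧ (y c ∧ f (W ∖ b ∖ c))))))

pairTerm-swap : ∀ {n} (x y : Fin n → F₂) (f : Subset n → F₂) W b c →
  pairTerm x y f W b c ≡ pairTerm y x f W c b
pairTerm-swap x y f W b c =
  begin
    lookup W b ∧ (x b ∧ (lookup (W ∖ b) c ∧ (y c ∧ f (W ∖ b ∖ c))))
  ≡⟨ regroup (lookup W b) (x b) (lookup (W ∖ b) c) (y c) _ ⟩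
    (lookup W b ∧ lookup (W ∖ b) c) ∧ (x b ∧ (y c ∧ f (W ∖ b ∖ c)))
  ≡⟨ cong₂ (λ m X → m ∧ (x b ∧ (y c ∧ f X))) (∖-pair-sym W b c) (∖-comm W b c) ⟩
    (lookup W c ∧ lookup (W ∖ c) b) ∧ (x b ∧ (y c ∧ f (W ∖ c ∖ b)))
  ≡⟨ ungroup (lookup W c) (lookup (W ∖ c) b) (y c) (x b) _ ⟩
    lookup W c ∧ (y c ∧ (lookup (W ∖ c) b ∧ (x b ∧ f (W ∖ c ∖ b))))
  ∎
  where
  open ≡-Reasoning
  regroup : ∀ w p v q d → w ∧ (p ∧ (v ∧ (q ∧ d))) ≡ (w ∧ v) ∧ (p ∧ (q ∧ d))
  regroup = solve-∀ F₂-ring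
  ungroup : ∀ w v q p d → (w ∧ v) ∧ (p ∧ (q ∧ d)) ≡ w ∧ (q ∧ (v ∧ (p ∧ d)))
  ungroup = solve-∀ F₂-ring

expand-swap : ∀ {n} (x y : Fin n → F₂) (f : Subset n → F₂) W →
  expand x (expand y f) W ≡ expand y (expand x f) W
expand-swap x y f W =
  begin
    expand x (expand y f) W
  ≡⟨ expand²-as-Σ₂ x y f W ⟩
    Σ₂ (λ b → Σ₂ (λ c → pairTerm x y f W b c))
  ≡⟨ Σ₂-swap (pairTerm x y f W) ⟩
    Σ₂ (λ c → Σ₂ (λ b → pairTerm x y f W b c))
  ≡⟨ Σ₂-cong (λ c → Σ₂-cong (λ b → pairTerm-swap x y f W b c)) ⟩
    Σ₂ (λ c → Σ₂ (λ b → pairTerm y x f W c b))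
  ≡⟨ sym (expand²-as-Σ₂ y x f W) ⟩
    expand y (expand x f) W
  ∎
  where open ≡-Reasoning

expand-twice : ∀ {n} (x : Fin n → F₂) (f : Subset n → F₂) W → expand x (expand x f) W ≡ false
expand-twice x f W =
  trans (expand²-as-Σ₂ x x f W) (Σ₂-symmetric (pairTerm x x f W) (pairTerm-swap x x f W) diagonal)
  where
  diagonal : ∀ b → pairTerm x x f W b b ≡ false
  diagonal b rewrite ∖-removes W b | ∧-zeroʳ (x b) = ∧-zeroʳ (lookup W b)

ExpandsAt : ∀ {n} → Mat n → (Subset n → F₂) → Fin n → Set
ExpandsAt M f t = ∀ S → t ∈ₛ S → f S ≡ (M t t ∧ f (S ∖ t)) xor expand (M t) f (S ∖ t)

expand-at : ∀ {n} (M : Mat n) (f : Subset n → F₂) t → ExpandsAt M f t →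
  ∀ U → t ∈ₛ U → (r : Fin n → F₂) →
  Σ₂ (λ b → lookup (U ∖ t) b ∧ (r b ∧ f (U ∖ b)))
    ≡ (M t t ∧ expand r f (U ∖ t)) xor expand r (expand (M t) f) (U ∖ t)
expand-at M f t f-expands U t∈U r =
  begin
    Σ₂ (λ b → lookup W b ∧ (r b ∧ f (U ∖ b)))
  ≡⟨ Σ∈-cong W (λ b b∈W → cong (r b ∧_) (expand-f b b∈W)) ⟩
    expand r (λ X → (M t t ∧ f X) xor expand (M t) f X) W
  ≡⟨ expand-xor r (λ X → M t t ∧ f X) (expand (M t) f) W ⟩
    expand r (λ X → M t t ∧ f X) W xor expand r (expand (M t) f) W
  ≡⟨ cong (_xor expand r (expand (M t) f) W) (expand-∧ r (M t t) f W) ⟩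
    (M t t ∧ expand r f W) xor expand r (expand (M t) f) W
  ∎
  where
  open ≡-Reasoning
  W = U ∖ t
  expand-f : ∀ b → b ∈ₛ W → f (U ∖ b) ≡ (M t t ∧ f (W ∖ b)) xor expand (M t) f (W ∖ b)
  expand-f b b∈W =
    trans (f-expands (U ∖ b) (∈-∖-swap U t b t∈U b∈W))
          (cong (λ X → (M t t ∧ f X) xor expand (M t) f X) (∖-comm U b t))

-- The determinant of a symmetric matrix over F₂

_↓ : ∀ {n} → Mat (suc n) → Mat n
(M ↓) i j = M (suc i) (suc j)

-- det M S is the determinant of the principal submatrix of M on S, computed by
-- expansion along its first row.  For symmetric M over F₂ the cofactor of an
-- off-diagonal entry (0,b) equals M₀ᵦ times the principal minor on S ∖ {0,b},
-- because the permutations that are not involutions cancel in pairs.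
det : ∀ {n} → Mat n → Subset n → F₂
det {zero}  M []          = true
det {suc n} M (false ∷ S) = det (M ↓) S
det {suc n} M (true  ∷ S) = (M zero zero ∧ det (M ↓) S) xor expand (M zero ∘ suc) (det (M ↓)) S

det-empty : ∀ {n} (M : Mat n) S → (∀ i → lookup S i ≡ false) → det M S ≡ true
det-empty {zero}  M []          empty = refl
det-empty {suc n} M (false ∷ S) empty = det-empty (M ↓) S (empty ∘ suc)
det-empty {suc n} M (true  ∷ S) empty with empty zero
... | ()

det-local : ∀ {n} (M M′ : Mat n) S →
  (∀ i j → i ∈ₛ S → j ∈ₛ S → M i j ≡ M′ i j) → det M S ≡ det M′ S
det-local {zero}  M M′ []          agree = refl
det-local {suc n} M M′ (false ∷ S) agree = det-local (M ↓) (M′ ↓) S (λ i j → agree (suc i) (suc j))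
det-local {suc n} M M′ (true  ∷ S) agree =
  cong₂ _xor_ (cong₂ _∧_ (agree zero zero refl refl) (det-local (M ↓) (M′ ↓) S agree↓))
    (expand-cong S {f = det (M ↓)} {g = det (M′ ↓)} (λ b b∈ → agree zero (suc b) refl b∈)
       (λ b b∈ → det-local (M ↓) (M′ ↓) (S ∖ b)
                   (λ i j i∈ j∈ → agree↓ i j (∖-⊆ S b i i∈) (∖-⊆ S b j j∈))))
  where
  agree↓ : ∀ i j → i ∈ₛ S → j ∈ₛ S → (M ↓) i j ≡ (M′ ↓) i j
  agree↓ i j = agree (suc i) (suc j)

det-expands : ∀ {n} (M : Mat n) → Symmetric M → ∀ t → ExpandsAt M (det M) t
det-expands M sym-M zero    (true  ∷ S) refl = refl
det-expands M sym-M (suc a) (false ∷ S) a∈S  = det-expands (M ↓) (λ i j → sym-M (suc i) (suc j)) a S a∈S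
det-expands M sym-M (suc a) (true  ∷ S) a∈S  =
  begin
    (m00 ∧ det↓ S) xor expand M₀ det↓ S
  ≡⟨ cong₂ (λ d e → (m00 ∧ d) xor e) (expands↓ S a∈S) first-row ⟩
    (m00 ∧ ((maa ∧ dW) xor P)) xor ((m0a ∧ dW) xor ((maa ∧ Q) xor expand M₀ (expand Mₐ det↓) W))
  ≡⟨ cong₂ (λ m e → (m00 ∧ ((maa ∧ dW) xor P)) xor ((m ∧ dW) xor ((maa ∧ Q) xor e)))
       (sym-M zero (suc a)) (expand-swap M₀ Mₐ det↓ W) ⟩
    (m00 ∧ ((maa ∧ dW) xor P)) xor ((ma0 ∧ dW) xor ((maa ∧ Q) xor R))
  ≡⟨ rearrange m00 maa dW P ma0 Q R ⟩
    (maa ∧ ((m00 ∧ dW) xor Q)) xor ((ma0 ∧ dW) xor ((m00 ∧ P) xor R))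
  ≡⟨ cong (λ e → (maa ∧ ((m00 ∧ dW) xor Q)) xor ((ma0 ∧ dW) xor e)) (sym row-a) ⟩
    (maa ∧ det M (true ∷ W)) xor expand (M (suc a)) (det M) (true ∷ W)
  ∎
  where
  open ≡-Reasoning
  det↓ = det (M ↓)
  expands↓ = det-expands (M ↓) (λ i j → sym-M (suc i) (suc j)) a
  W = S ∖ a
  M₀ Mₐ : _ → F₂
  M₀ = M zero ∘ suc
  Mₐ = M (suc a) ∘ suc
  m00 = M zero zero
  maa = M (suc a) (suc a)
  m0a = M zero (suc a)
  ma0 = M (suc a) zero
  dW = det↓ W
  P = expand Mₐ det↓ W
  Q = expand M₀ det↓ W
  R = expand Mₐ (expand M₀ det↓) W
  first-row : expand M₀ det↓ S ≡ (m0a ∧ dW) xor ((maa ∧ Q) xor expand M₀ (expand Mₐ det↓) W)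
  first-row = trans (expand-split M₀ det↓ S a a∈S)
                    (cong ((m0a ∧ dW) xor_) (expand-at (M ↓) det↓ a expands↓ S a∈S M₀))
  row-a : Σ₂ (λ b → lookup W b ∧ (M (suc a) (suc b) ∧ det M (true ∷ W ∖ b))) ≡ (m00 ∧ P) xor R
  row-a = trans (expand-xor Mₐ (λ X → m00 ∧ det↓ X) (expand M₀ det↓) W)
                (cong (_xor R) (expand-∧ Mₐ m00 det↓ W))
  rearrange : ∀ m00 maa dW P ma0 Q R →
    (m00 ∧ ((maa ∧ dW) xor P)) xor ((ma0 ∧ dW) xor ((maa ∧ Q) xor R))
      ≡ (maa ∧ ((m00 ∧ dW) xor Q)) xor ((ma0 ∧ dW) xor ((m00 ∧ P) xor R))
  rearrange = solve-∀ F₂-ring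

-- For t ∈ U, replacing row and column a ∉ U by copies of row and column t
-- gives a singular matrix on U ∪ {a}; its expansion at a is the left side.
det-duplicate-row : ∀ {n} (M : Mat n) → Symmetric M → ∀ U t → t ∈ₛ U →
  (M t t ∧ det M U) xor expand (M t) (det M) U ≡ false
det-duplicate-row M sym-M U t t∈U =
  begin
    (mtt ∧ det M U) xor expand (M t) (det M) U
  ≡⟨ cong₂ (λ d e → (mtt ∧ d) xor e)
       (det-expands M sym-M t U t∈U) (expand-split (M t) (det M) U t t∈U) ⟩
    (mtt ∧ ((mtt ∧ dW) xor R)) xor ((mtt ∧ dW) xor Σ₂ (λ b → lookup W b ∧ (M t b ∧ det M (U ∖ b))))
  ≡⟨ cong (λ e → (mtt ∧ ((mtt ∧ dW) xor R)) xor ((mtt ∧ dW) xor e))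
       (expand-at M (det M) t (det-expands M sym-M t) U t∈U (M t)) ⟩
    (mtt ∧ ((mtt ∧ dW) xor R)) xor ((mtt ∧ dW) xor ((mtt ∧ R) xor expand (M t) (expand (M t) (det M)) W))
  ≡⟨ cong (λ e → (mtt ∧ ((mtt ∧ dW) xor R)) xor ((mtt ∧ dW) xor ((mtt ∧ R) xor e)))
       (expand-twice (M t) (det M) W) ⟩
    (mtt ∧ ((mtt ∧ dW) xor R)) xor ((mtt ∧ dW) xor ((mtt ∧ R) xor false))
  ≡⟨ cancel mtt dW R ⟩
    false
  ∎
  where
  open ≡-Reasoning
  W = U ∖ t
  mtt = M t t
  dW = det M W
  R = expand (M t) (det M) W
  cancel : ∀ m d r → (m ∧ ((m ∧ d) xor r)) xor ((m ∧ d) xor ((m ∧ r) xor false)) ≡ false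
  cancel false d r = refl
  cancel true  d r =
    trans (cong ((d xor r) xor_) (trans (sym (xor-assoc d r false)) (xor-identityʳ (d xor r))))
          (xor-same (d xor r))

-- Adding row and column t to row and column a (the congruence E M Eᵀ for the
-- elementary matrix E = I + e_a e_tᵀ); written so that it visibly agrees with M
-- away from row and column a.
addRowCol : ∀ {n} → Mat n → Fin n → Fin n → Mat n
addRowCol M a t i j = (δ i a ∧ (δ j a ∧ M t t)) xor ((δ j a ∧ M i t) xor ((δ i a ∧ M t j) xor M i j))

addRowCol-sym : ∀ {n} (M : Mat n) → Symmetric M → ∀ a t → Symmetric (addRowCol M a t)
addRowCol-sym M sym-M a t i j
  rewrite sym-M i j | sym-M i t | sym-M t j = swap (δ i a) (δ j a) (M t t) (M t i) (M j t) (M j i)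
  where
  swap : ∀ di dj mtt mti mjt mji →
    (di ∧ (dj ∧ mtt)) xor ((dj ∧ mti) xor ((di ∧ mjt) xor mji))
      ≡ (dj ∧ (di ∧ mtt)) xor ((di ∧ mjt) xor ((dj ∧ mti) xor mji))
  swap = solve-∀ F₂-ring

addRowCol-outside : ∀ {n} (M : Mat n) a t i j → δ i a ≡ false → δ j a ≡ false →
  addRowCol M a t i j ≡ M i j
addRowCol-outside M a t i j i≢a j≢a rewrite i≢a | j≢a = refl

addRowCol-row : ∀ {n} (M : Mat n) a t b → δ b a ≡ false → addRowCol M a t a b ≡ M t b xor M a b
addRowCol-row M a t b b≢a rewrite δ-refl a | b≢a = refl

addRowCol-diag : ∀ {n} (M : Mat n) → Symmetric M → ∀ a t → addRowCol M a t a a ≡ M t t xor M a a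
addRowCol-diag M sym-M a t rewrite δ-refl a | sym-M t a = cong (M t t xor_) (xor-cancelˡ (M a t) (M a a))

det-addRowCol : ∀ {n} (M : Mat n) → Symmetric M → ∀ S a t → δ t a ≡ false → a ∈ₛ S → t ∈ₛ S →
  det (addRowCol M a t) S ≡ det M S
det-addRowCol M sym-M S a t t≢a a∈S t∈S =
  begin
    det M′ S
  ≡⟨ det-expands M′ (addRowCol-sym M sym-M a t) a S a∈S ⟩
    (M′ a a ∧ det M′ W) xor expand (M′ a) (det M′) W
  ≡⟨ cong₂ _xor_ (cong₂ _∧_ (addRowCol-diag M sym-M a t) (unchanged W (∖-≢ S a)))
       (expand-cong W {f = det M′} {g = det M} (λ b b∈W → addRowCol-row M a t b (∖-≢ S a b b∈W))
          (λ b b∈W → unchanged (W ∖ b) (λ i i∈ → ∖-≢ S a i (∖-⊆ W b i i∈)))) ⟩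
    ((mtt xor maa) ∧ dW) xor expand (λ b → M t b xor M a b) (det M) W
  ≡⟨ cong (((mtt xor maa) ∧ dW) xor_) (expand-xorʳ (M t) (M a) (det M) W) ⟩
    ((mtt xor maa) ∧ dW) xor (expand (M t) (det M) W xor expand (M a) (det M) W)
  ≡⟨ regroup mtt maa dW (expand (M t) (det M) W) (expand (M a) (det M) W) ⟩
    ((mtt ∧ dW) xor expand (M t) (det M) W) xor ((maa ∧ dW) xor expand (M a) (det M) W)
  ≡⟨ cong₂ _xor_ (det-duplicate-row M sym-M W t (∖-keeps S a t t∈S t≢a))
                 (sym (det-expands M sym-M a S a∈S)) ⟩
    det M S
  ∎
  where
  open ≡-Reasoning
  M′ = addRowCol M a t
  W = S ∖ a
  mtt = M t t
  maa = M a a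
  dW = det M W
  unchanged : ∀ U → (∀ i → i ∈ₛ U → δ i a ≡ false) → det M′ U ≡ det M U
  unchanged U outside-a =
    det-local M′ M U (λ i j i∈ j∈ → addRowCol-outside M a t i j (outside-a i i∈) (outside-a j j∈))
  regroup : ∀ x y d p q → ((x xor y) ∧ d) xor (p xor q) ≡ ((x ∧ d) xor p) xor ((y ∧ d) xor q)
  regroup = solve-∀ F₂-ring

-- Singular principal minors

RowsCancelOn : ∀ {n} → Mat n → Subset n → Subset n → Set
RowsCancelOn M T S = ∀ j → j ∈ₛ S → rowSum M T j ≡ false

rowSum-addRowCol : ∀ {n} (M : Mat n) T a t → a ∈ₛ T → t ∈ₛ T ∖ a → ∀ j →
  rowSum (addRowCol M a t) (T ∖ t) j ≡ (δ j a ∧ rowSum M T t) xor rowSum M T j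
rowSum-addRowCol {n} M T a t a∈T t∈T∖a j =
  begin
    Σ₂ (λ i → lookup T′ i ∧ addRowCol M a t i j)
  ≡⟨ Σ₂-cong (λ i → distrib (lookup T′ i) (δ i a) d (M t t) (M i t) (M t j) (M i j)) ⟩
    Σ₂ (λ i → (Tδ i ∧ (d ∧ M t t))
                xor ((d ∧ (lookup T′ i ∧ M i t)) xor ((Tδ i ∧ M t j) xor (lookup T′ i ∧ M i j))))
  ≡⟨ Σ₂-xor₄ _ _ _ _ ⟩
    Σ₂ (λ i → Tδ i ∧ (d ∧ M t t)) xor (Σ₂ (λ i → d ∧ (lookup T′ i ∧ M i t)) xor (Σ₂ (λ i → Tδ i ∧ M t j) xor R j))
  ≡⟨ cong₂ (λ u v → u xor (v xor (Σ₂ (λ i → Tδ i ∧ M t j) xor R j)))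
       (pick (d ∧ M t t)) (sym (Σ₂-∧ˡ d (λ i → lookup T′ i ∧ M i t))) ⟩
    (d ∧ M t t) xor ((d ∧ R t) xor (Σ₂ (λ i → Tδ i ∧ M t j) xor R j))
  ≡⟨ cong (λ u → (d ∧ M t t) xor ((d ∧ R t) xor (u xor R j))) (pick (M t j)) ⟩
    (d ∧ M t t) xor ((d ∧ R t) xor (M t j xor R j))
  ≡⟨ collect d (M t t) (R t) (M t j xor R j) ⟩
    (d ∧ (M t t xor R t)) xor (M t j xor R j)
  ≡⟨ sym (cong₂ (λ u v → (d ∧ u) xor v) (split t) (split j)) ⟩
    (d ∧ rowSum M T t) xor rowSum M T j
  ∎
  where
  open ≡-Reasoning
  T′ = T ∖ t
  d = δ j a
  R : Fin n → F₂
  R = rowSum M T′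
  Tδ : Fin n → F₂
  Tδ i = lookup T′ i ∧ δ i a
  -- a ∈ T′, so summing against δ(·, a) over T′ picks out one term
  pick : ∀ c → Σ₂ (λ i → Tδ i ∧ c) ≡ c
  pick c = trans (sym (Σ₂-∧ʳ Tδ c)) (cong (_∧ c) (trans (Σ₂-δ T′ a) (∈-∖-swap T a t a∈T t∈T∖a)))
  split : ∀ k → rowSum M T k ≡ M t k xor R k
  split k = Σ∈-split T t (λ i → M i k) (∖-⊆ T a t t∈T∖a)
  Σ₂-xor₄ : ∀ (f g h e : Fin n → F₂) →
    Σ₂ (λ i → f i xor (g i xor (h i xor e i))) ≡ Σ₂ f xor (Σ₂ g xor (Σ₂ h xor Σ₂ e))
  Σ₂-xor₄ f g h e =
    trans (Σ₂-xor f _) (cong (Σ₂ f xor_) (trans (Σ₂-xor g _) (cong (Σ₂ g xor_) (Σ₂-xor h e))))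
  distrib : ∀ τ di dj mtt mit mtj mij →
    τ ∧ ((di ∧ (dj ∧ mtt)) xor ((dj ∧ mit) xor ((di ∧ mtj) xor mij)))
      ≡ ((τ ∧ di) ∧ (dj ∧ mtt)) xor ((dj ∧ (τ ∧ mit)) xor (((τ ∧ di) ∧ mtj) xor (τ ∧ mij)))
  distrib = solve-∀ F₂-ring
  collect : ∀ d m r u → (d ∧ m) xor ((d ∧ r) xor u) ≡ (d ∧ (m xor r)) xor u
  collect = solve-∀ F₂-ring

expand-zero-row : ∀ {n} (r : Fin n → F₂) (f : Subset n → F₂) W → (∀ b → b ∈ₛ W → r b ≡ false) →
  expand r f W ≡ false
expand-zero-row r f W r≡0 = Σ₂-zero vanishes
  where
  vanishes : ∀ b → lookup W b ∧ (r b ∧ f (W ∖ b)) ≡ false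
  vanishes b with lookup W b in b∈W
  ... | false = refl
  ... | true rewrite r≡0 b b∈W = refl

-- Induction on ∣ T ∣: congruences shrink T
-- until it is a single row, which is then zero on S.
det-dependent : ∀ m {n} (M : Mat n) → Symmetric M → ∀ S T a → ∣ T ∣ ≤ m →
  (∀ i → i ∈ₛ T → i ∈ₛ S) → a ∈ₛ T → RowsCancelOn M T S → det M S ≡ false
det-dependent zero M sym-M S T a ∣T∣≤0 T⊆S a∈T cancels
  with subst (_≤ 0) (sym (∣∖∣ T a a∈T)) ∣T∣≤0
... | ()
det-dependent (suc m) M sym-M S T a ∣T∣≤1+m T⊆S a∈T cancels with member-or-empty (T ∖ a)
... | inj₂ T∖a-empty =
  trans (det-expands M sym-M a S a∈S)
        (cong₂ _xor_ (cong (_∧ det M (S ∖ a)) (row-a-zero a a∈S))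
                     (expand-zero-row (M a) (det M) (S ∖ a) (λ b b∈ → row-a-zero b (∖-⊆ S a b b∈))))
  where
  a∈S = T⊆S a a∈T
  -- T = {a}, so row a itself vanishes on S
  row-a-zero : ∀ j → j ∈ₛ S → M a j ≡ false
  row-a-zero j j∈S =
    begin
      M a j
    ≡⟨ sym (xor-identityʳ (M a j)) ⟩
      M a j xor false
    ≡⟨ cong (M a j xor_) (sym (Σ₂-zero (λ i → cong (_∧ M i j) (T∖a-empty i)))) ⟩
      M a j xor rowSum M (T ∖ a) j
    ≡⟨ sym (Σ∈-split T a (λ i → M i j) a∈T) ⟩
      rowSum M T j
    ≡⟨ cancels j j∈S ⟩
      false
    ∎
    where open ≡-Reasoning
... | inj₁ (t , t∈T∖a) =
  trans (sym (det-addRowCol M sym-M S a t t≢a a∈S (T⊆S t t∈T)))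
        (det-dependent m (addRowCol M a t) (addRowCol-sym M sym-M a t) S (T ∖ t) a smaller
           (λ i i∈ → T⊆S i (∖-⊆ T t i i∈)) (∈-∖-swap T a t a∈T t∈T∖a) still-cancels)
  where
  a∈S = T⊆S a a∈T
  t≢a = ∖-≢ T a t t∈T∖a
  t∈T = ∖-⊆ T a t t∈T∖a
  smaller : ∣ T ∖ t ∣ ≤ m
  smaller = s≤s⁻¹ (subst (_≤ suc m) (sym (∣∖∣ T t t∈T)) ∣T∣≤1+m)
  still-cancels : RowsCancelOn (addRowCol M a t) (T ∖ t) S
  still-cancels j j∈S =
    trans (rowSum-addRowCol M T a t a∈T t∈T∖a j)
          (trans (cong₂ (λ u v → (δ j a ∧ u) xor v) (cancels t (T⊆S t t∈T)) (cancels j j∈S))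
                 (trans (xor-identityʳ (δ j a ∧ false)) (∧-zeroʳ (δ j a))))

allᵇ-holds : ∀ {A : Set} (p : A → Bool) → (∀ x → p x ≡ true) → ∀ xs → allᵇ p xs ≡ true
allᵇ-holds p holds []       = refl
allᵇ-holds p holds (x ∷ xs) rewrite holds x = allᵇ-holds p holds xs

⊆ᵇ-sound : ∀ {n} (T S : Subset n) → (T ⊆ᵇ S) ≡ true → ∀ i → i ∈ₛ T → i ∈ₛ S
⊆ᵇ-sound (true  ∷ T) (true  ∷ S) T⊆S zero    i∈ = refl
⊆ᵇ-sound (true  ∷ T) (false ∷ S) ()  zero    i∈
⊆ᵇ-sound (x     ∷ T) (y     ∷ S) T⊆S (suc i) i∈ = ⊆ᵇ-sound T S (∧-conicalʳ _ _ T⊆S) i i∈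

nonempty-member : ∀ {n} (T : Subset n) → not (isEmpty T) ≡ true → Σ (Fin n) (_∈ₛ T)
nonempty-member (true  ∷ T) T≠∅ = zero , refl
nonempty-member (false ∷ T) T≠∅ with nonempty-member T T≠∅
... | a , a∈T = suc a , a∈T

isZeroVec-sound : ∀ {n} (v : Fin n → F₂) → isZeroVec v ≡ true → ∀ j → v j ≡ false
isZeroVec-sound v v≡0 zero    with v zero | ∧-conicalˡ (not (v zero)) _ v≡0
... | false | _ = refl
isZeroVec-sound v v≡0 (suc j) = isZeroVec-sound (v ∘ suc) (∧-conicalʳ (not (v zero)) _ v≡0) j

allVecs-complete : ∀ {n} (v : Vec F₂ n) → v ∈ allVecs n
allVecs-complete []                = here refl
allVecs-complete {suc n} (false ∷ v) = ∈-++⁺ˡ (∈-map⁺ (false ∷_) (allVecs-complete v))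
allVecs-complete {suc n} (true  ∷ v) =
  ∈-++⁺ʳ (map (false ∷_) (allVecs n)) (∈-map⁺ (true ∷_) (allVecs-complete v))

det-independent : ∀ {n} (M : Mat n) → Symmetric M → ∀ S → det M S ≡ true → independentᵇ M S ≡ true
det-independent {n} M sym-M S det≡1 = allᵇ-holds _ no-dependency (allVecs n)
  where
  no-dependency : ∀ T → not ((T ⊆ᵇ S) ∧ (not (isEmpty T) ∧ isZeroVec (rowSum M T))) ≡ true
  no-dependency T with (T ⊆ᵇ S) in T⊆S | not (isEmpty T) in T≢∅ | isZeroVec (rowSum M T) in sum≡0
  ... | false | _     | _     = refl
  ... | true  | false | _     = refl
  ... | true  | true  | false = refl
  ... | true  | true  | true  with nonempty-member T T≢∅
  ... | a , a∈T = contradiction (trans (sym det≡1) singular) λ ()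
    where
    singular : det M S ≡ false
    singular = det-dependent ∣ T ∣ M sym-M S T a ≤-refl (⊆ᵇ-sound T S T⊆S) a∈T
                 (λ j _ → isZeroVec-sound (rowSum M T) sum≡0 j)

≤-foldr-⊔ : ∀ {A : Set} (f : A → ℕ) {x} xs → x ∈ xs → f x ≤ foldr (λ y r → f y ⊔ r) 0 xs
≤-foldr-⊔ f (y ∷ xs) (here refl) = m≤m⊔n (f y) _
≤-foldr-⊔ f (y ∷ xs) (there x∈)  = ≤-trans (≤-foldr-⊔ f xs x∈) (m≤n⊔m (f y) _)

rank-≥ : ∀ {n} (M : Mat n) → Symmetric M → ∀ S → det M S ≡ true → ∣ S ∣ ≤ rank M
rank-≥ {n} M sym-M S det≡1 =
  subst (_≤ rank M) counted
    (≤-foldr-⊔ (λ T → if independentᵇ M T then ∣ T ∣ else 0) (allVecs n) (allVecs-complete S))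
  where
  counted : (if independentᵇ M S then ∣ S ∣ else 0) ≡ ∣ S ∣
  counted rewrite det-independent M sym-M S det≡1 = refl

-- Polynomial functions on F₂ⁿ

mono : ∀ {n} → Subset n → Vec F₂ n → F₂
mono []          []      = true
mono (false ∷ s) (_ ∷ z) = mono s z
mono (true  ∷ s) (x ∷ z) = x ∧ mono s z

poly : ∀ {n} → List (Subset n) → Vec F₂ n → F₂
poly []      z = false
poly (s ∷ q) z = mono s z xor poly q z

mono-empty : ∀ {n} (s : Subset n) z → (∀ i → lookup s i ≡ false) → mono s z ≡ true
mono-empty []          []      empty = refl
mono-empty (false ∷ s) (_ ∷ z) empty = mono-empty s z (empty ∘ suc)
mono-empty (true  ∷ s) (_ ∷ z) empty with empty zero
... | ()

mono-⊥ : ∀ {n} (z : Vec F₂ n) → mono ⊥ z ≡ true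
mono-⊥ z = mono-empty ⊥ z (λ i → lookup-replicate i false)

mono-⁅⁆ : ∀ {n} (a : Fin n) z → mono ⁅ a ⁆ z ≡ lookup z a
mono-⁅⁆ zero    (x ∷ z) = trans (cong (x ∧_) (mono-⊥ z)) (∧-identityʳ x)
mono-⁅⁆ (suc a) (x ∷ z) = mono-⁅⁆ a z

mono-∪ : ∀ {n} (s t : Subset n) z → mono (s ∪ t) z ≡ mono s z ∧ mono t z
mono-∪ []          []          []      = refl
mono-∪ (false ∷ s) (false ∷ t) (x ∷ z) = mono-∪ s t z
mono-∪ (false ∷ s) (true  ∷ t) (x ∷ z) = trans (cong (x ∧_) (mono-∪ s t z)) (exchange x (mono s z) (mono t z))
  where
  exchange : ∀ x a b → x ∧ (a ∧ b) ≡ a ∧ (x ∧ b)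
  exchange = solve-∀ F₂-ring
mono-∪ (true  ∷ s) (false ∷ t) (x ∷ z) = trans (cong (x ∧_) (mono-∪ s t z)) (sym (∧-assoc x (mono s z) (mono t z)))
mono-∪ (true  ∷ s) (true  ∷ t) (x ∷ z) =
  trans (cong (x ∧_) (mono-∪ s t z)) (duplicate x (mono s z) (mono t z))
  where
  duplicate : ∀ x a b → x ∧ (a ∧ b) ≡ (x ∧ a) ∧ (x ∧ b)
  duplicate false a b = refl
  duplicate true  a b = refl

mono-∖ : ∀ {n} (s : Subset n) a z → a ∈ₛ s → mono s z ≡ lookup z a ∧ mono (s ∖ a) z
mono-∖ (true  ∷ s) zero    (x ∷ z) refl = refl
mono-∖ (false ∷ s) (suc a) (x ∷ z) a∈s  = mono-∖ s a z a∈s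
mono-∖ (true  ∷ s) (suc a) (x ∷ z) a∈s  =
  trans (cong (x ∧_) (mono-∖ s a z a∈s)) (exchange x (lookup z a) (mono (s ∖ a) z))
  where
  exchange : ∀ x a b → x ∧ (a ∧ b) ≡ a ∧ (x ∧ b)
  exchange = solve-∀ F₂-ring

poly-++ : ∀ {n} (p q : List (Subset n)) z → poly (p ++ q) z ≡ poly p z xor poly q z
poly-++ []      q z = refl
poly-++ (s ∷ p) q z =
  trans (cong (mono s z xor_) (poly-++ p q z)) (sym (xor-assoc (mono s z) (poly p z) (poly q z)))

poly-times-mono : ∀ {n} (s : Subset n) q z → poly (map (s ∪_) q) z ≡ mono s z ∧ poly q z
poly-times-mono s []      z = sym (∧-zeroʳ (mono s z))
poly-times-mono s (t ∷ q) z =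
  trans (cong₂ _xor_ (mono-∪ s t z) (poly-times-mono s q z)) (sym (distrib (mono s z) (mono t z) (poly q z)))
  where
  distrib : ∀ x a b → x ∧ (a xor b) ≡ (x ∧ a) xor (x ∧ b)
  distrib = solve-∀ F₂-ring

∣∪∣≤ : ∀ {n} (s t : Subset n) → ∣ s ∪ t ∣ ≤ ∣ s ∣ + ∣ t ∣
∣∪∣≤ []          []          = z≤n
∣∪∣≤ (false ∷ s) (false ∷ t) = ∣∪∣≤ s t
∣∪∣≤ (false ∷ s) (true  ∷ t) = subst (suc ∣ s ∪ t ∣ ≤_) (sym (+-suc ∣ s ∣ ∣ t ∣)) (s≤s (∣∪∣≤ s t))
∣∪∣≤ (true  ∷ s) (false ∷ t) = s≤s (∣∪∣≤ s t)
∣∪∣≤ (true  ∷ s) (true  ∷ t) = s≤s (≤-trans (∣∪∣≤ s t) (+-monoʳ-≤ ∣ s ∣ (n≤1+n ∣ t ∣)))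

-- f agrees, at the points satisfying Z, with a sum of monomials z^s for s satisfying P.
record Spanned {n} (P : Subset n → Set) (Z : Vec F₂ n → Set) (f : Vec F₂ n → F₂) : Set where
  constructor spanned
  field
    terms   : List (Subset n)
    allowed : All P terms
    agrees  : ∀ z → Z z → f z ≡ poly terms z

Everywhere : ∀ {n} → Vec F₂ n → Set
Everywhere _ = ⊤

module _ {n} {P : Subset n → Set} {Z : Vec F₂ n → Set} where

  Spanned-cong : ∀ {f g} → (∀ z → Z z → f z ≡ g z) → Spanned P Z g → Spanned P Z f
  Spanned-cong f≡g (spanned q q⊆P g≡q) = spanned q q⊆P (λ z Zz → trans (f≡g z Zz) (g≡q z Zz))

  Spanned-zero : Spanned P Z (λ _ → false)
  Spanned-zero = spanned [] [] (λ _ _ → refl)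

  Spanned-mono : ∀ {s} → P s → Spanned P Z (mono s)
  Spanned-mono {s} Ps = spanned (s ∷ []) (Ps ∷ []) (λ z _ → sym (xor-identityʳ (mono s z)))

  Spanned-xor : ∀ {f g} → Spanned P Z f → Spanned P Z g → Spanned P Z (λ z → f z xor g z)
  Spanned-xor (spanned p p⊆P f≡p) (spanned q q⊆P g≡q) =
    spanned (p ++ q) (All.++⁺ p⊆P q⊆P)
      (λ z Zz → trans (cong₂ _xor_ (f≡p z Zz) (g≡q z Zz)) (sym (poly-++ p q z)))

  Spanned-poly : ∀ q → All (λ s → Spanned P Z (mono s)) q → Spanned P Z (poly q)
  Spanned-poly []      []         = Spanned-zero
  Spanned-poly (s ∷ q) (Ss ∷ Sq) = Spanned-xor Ss (Spanned-poly q Sq)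

  Spanned-when : ∀ c {f} → (c ≡ true → Spanned P Z f) → Spanned P Z (λ z → c ∧ f z)
  Spanned-when false Sf = Spanned-zero
  Spanned-when true  Sf = Sf refl

  Spanned-Σ₂ : ∀ {m} {f : Fin m → Vec F₂ n → F₂} → (∀ b → Spanned P Z (f b)) →
    Spanned P Z (λ z → Σ₂ (λ b → f b z))
  Spanned-Σ₂ {zero}  Sf = Spanned-zero
  Spanned-Σ₂ {suc m} Sf = Spanned-xor (Sf zero) (Spanned-Σ₂ (Sf ∘ suc))

Spanned-weaken : ∀ {n} {P Q : Subset n → Set} {Z f} → (∀ {s} → P s → Q s) → Spanned P Z f → Spanned Q Z f
Spanned-weaken P⇒Q (spanned q q⊆P f≡q) = spanned q (All.map P⇒Q q⊆P) f≡q

Spanned-restrict : ∀ {n} {P : Subset n → Set} {Z Z′ f} → (∀ z → Z′ z → Z z) →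
  Spanned P Z f → Spanned P Z′ f
Spanned-restrict Z′⇒Z (spanned q q⊆P f≡q) = spanned q q⊆P (λ z Z′z → f≡q z (Z′⇒Z z Z′z))

Spanned-∧ : ∀ {n} {P Q R : Subset n → Set} {Z f g} → (∀ s t → P s → Q t → R (s ∪ t)) →
  Spanned P Z f → Spanned Q Z g → Spanned R Z (λ z → f z ∧ g z)
Spanned-∧ {P = P} {Q} {R} {Z} {f} {g} closed (spanned p p⊆P f≡p) (spanned q q⊆Q g≡q) =
  Spanned-cong (λ z Zz → cong (_∧ g z) (f≡p z Zz)) (times p p⊆P)
  where
  times-mono : ∀ {s} → P s → Spanned R Z (λ z → mono s z ∧ g z)
  times-mono {s} Ps =
    spanned (map (s ∪_) q) (All.map⁺ (All.map (closed s _ Ps) q⊆Q))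
            (λ z Zz → trans (cong (mono s z ∧_) (g≡q z Zz)) (sym (poly-times-mono s q z)))
  times : ∀ p → All P p → Spanned R Z (λ z → poly p z ∧ g z)
  times []      []          = Spanned-zero
  times (s ∷ p) (Ps ∷ p⊆P) =
    Spanned-cong (λ z _ → distrib (mono s z) (poly p z) (g z)) (Spanned-xor (times-mono Ps) (times p p⊆P))
    where
    distrib : ∀ a b c → (a xor b) ∧ c ≡ (a ∧ c) xor (b ∧ c)
    distrib = solve-∀ F₂-ring

-- Every function on F₂ⁿ is a polynomial function (Möbius inversion, one variable at a time).
interpolate : ∀ {n} → (Vec F₂ n → F₂) → List (Subset n)
interpolate {zero}  h = if h [] then [] ∷ [] else []
interpolate {suc n} h =
  map (false ∷_) (interpolate (λ z → h (false ∷ z)))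
    ++ map (true ∷_) (interpolate (λ z → h (false ∷ z) xor h (true ∷ z)))

poly-without : ∀ {n} (q : List (Subset n)) x z → poly (map (false ∷_) q) (x ∷ z) ≡ poly q z
poly-without []      x z = refl
poly-without (s ∷ q) x z = cong (mono s z xor_) (poly-without q x z)

poly-with : ∀ {n} (q : List (Subset n)) x z → poly (map (true ∷_) q) (x ∷ z) ≡ x ∧ poly q z
poly-with []      x z = sym (∧-zeroʳ x)
poly-with (s ∷ q) x z =
  trans (cong ((x ∧ mono s z) xor_) (poly-with q x z)) (sym (distrib x (mono s z) (poly q z)))
  where
  distrib : ∀ x a b → x ∧ (a xor b) ≡ (x ∧ a) xor (x ∧ b)
  distrib = solve-∀ F₂-ring

interpolate-correct : ∀ {n} (h : Vec F₂ n → F₂) z → poly (interpolate h) z ≡ h z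
interpolate-correct {zero} h [] with h []
... | false = refl
... | true  = refl
interpolate-correct {suc n} h (x ∷ z) =
  begin
    poly (map (false ∷_) (interpolate h₀) ++ map (true ∷_) (interpolate h₁)) (x ∷ z)
  ≡⟨ poly-++ (map (false ∷_) (interpolate h₀)) _ (x ∷ z) ⟩
    poly (map (false ∷_) (interpolate h₀)) (x ∷ z) xor poly (map (true ∷_) (interpolate h₁)) (x ∷ z)
  ≡⟨ cong₂ _xor_ (trans (poly-without (interpolate h₀) x z) (interpolate-correct h₀ z))
                 (trans (poly-with (interpolate h₁) x z) (cong (x ∧_) (interpolate-correct h₁ z))) ⟩
    h₀ z xor (x ∧ (h₀ z xor h (true ∷ z)))
  ≡⟨ by-value x ⟩
    h (x ∷ z)
  ∎
  where
  open ≡-Reasoning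
  h₀ h₁ : Vec F₂ n → F₂
  h₀ z = h (false ∷ z)
  h₁ z = h (false ∷ z) xor h (true ∷ z)
  by-value : ∀ x → h₀ z xor (x ∧ (h₀ z xor h (true ∷ z))) ≡ h (x ∷ z)
  by-value false = xor-identityʳ (h₀ z)
  by-value true  = xor-cancelˡ (h₀ z) (h (true ∷ z))

-- The leading term of a principal minor of an affine symmetric family

size-induction : ∀ {n} (P : Subset n → Set) → (∀ s → (∀ {t} → ∣ t ∣ < ∣ s ∣ → P t) → P s) → ∀ s → P s
size-induction P = WF.All.wfRec (On.wellFounded ∣_∣ <-wellFounded) _ P

Degree≤ : ∀ {n} → ℕ → Subset n → Set
Degree≤ d s = ∣ s ∣ ≤ d

Degree< : ∀ {n} → ℕ → Subset n → Set
Degree< d s = ∣ s ∣ < d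

leading⇒degree : ∀ {n} {Z : Vec F₂ n → Set} {f} S →
  Spanned (Degree< ∣ S ∣) Z (λ z → f z xor mono S z) → Spanned (Degree≤ ∣ S ∣) Z f
leading⇒degree {f = f} S lower =
  Spanned-cong (λ z _ → sym (trans (xor-assoc (f z) (mono S z) (mono S z))
                                   (trans (cong (f z xor_) (xor-same (mono S z))) (xor-identityʳ (f z)))))
    (Spanned-xor (Spanned-weaken <⇒≤ lower) (Spanned-mono {s = S} ≤-refl))

module LeadingTerm {N} (F : Vec F₂ N → Mat N) (c : Fin N → F₂)
  (F-sym : ∀ z → Symmetric (F z))
  (F-affine : ∀ i j → Spanned (Degree≤ 1) Everywhere (λ z → F z i j))
  (F-diag : ∀ z i → F z i i ≡ lookup z i xor c i) where

  Leading : Subset N → Set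
  Leading S = Spanned (Degree< ∣ S ∣) Everywhere (λ z → det (F z) S xor mono S z)

  -- Expanding at a ∈ S: det F(z) S + z^S
  --   = z(a)·(det F(z) W + z^W) + c(a)·det F(z) W + Σ_{b ∈ W} F(z)ₐᵦ · det F(z) (W ∖ b),
  -- where W = S ∖ a, and every summand has degree < ∣ S ∣ by induction.
  leading-at : ∀ S a → a ∈ₛ S → (∀ {T} → ∣ T ∣ < ∣ S ∣ → Leading T) → Leading S
  leading-at S a a∈S IH =
    Spanned-cong expansion
      (Spanned-xor (Spanned-∧ top-degree (Spanned-mono {s = ⁅ a ⁆} ∣⁅a⁆∣≤1) (IH ∣W∣<∣S∣))
        (Spanned-xor (Spanned-when (c a) (λ _ → Spanned-weaken (λ {s} → W-below-S {s}) degree-W))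
                     (Spanned-Σ₂ (λ b → Spanned-when (lookup W b) (λ b∈W → cofactor b b∈W)))))
    where
    W = S ∖ a
    ∣W∣<∣S∣ : ∣ W ∣ < ∣ S ∣
    ∣W∣<∣S∣ = ≤-reflexive (∣∖∣ S a a∈S)
    ∣⁅a⁆∣≤1 : ∣ ⁅ a ⁆ ∣ ≤ 1
    ∣⁅a⁆∣≤1 = ≤-reflexive (∣⁅x⁆∣≡1 a)
    degree-W : Spanned (Degree≤ ∣ W ∣) Everywhere (λ z → det (F z) W)
    degree-W = leading⇒degree W (IH ∣W∣<∣S∣)
    W-below-S : ∀ {s} → Degree≤ ∣ W ∣ s → Degree< ∣ S ∣ s
    W-below-S {s} s≤W = ≤-trans (s≤s s≤W) ∣W∣<∣S∣
    top-degree : ∀ s t → Degree≤ 1 s → Degree< ∣ W ∣ t → Degree< ∣ S ∣ (s ∪ t)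
    top-degree s t s≤1 t<W =
      ≤-trans (s≤s (≤-trans (∣∪∣≤ s t) (+-mono-≤ s≤1 ≤-refl))) (≤-trans (s≤s t<W) ∣W∣<∣S∣)
    -- F(z)ₐᵦ · det F(z) (W ∖ b) has degree ≤ 1 + ∣ W ∖ b ∣ = ∣ W ∣
    cofactor : ∀ b → b ∈ₛ W → Spanned (Degree< ∣ S ∣) Everywhere (λ z → F z a b ∧ det (F z) (W ∖ b))
    cofactor b b∈W =
      Spanned-∧ bound (F-affine a b) (leading⇒degree (W ∖ b) (IH (≤-trans (n≤1+n _) ∣W∖b∣<∣S∣)))
      where
      ∣W∖b∣<∣S∣ : suc ∣ W ∖ b ∣ < ∣ S ∣
      ∣W∖b∣<∣S∣ = ≤-trans (≤-reflexive (cong suc (∣∖∣ W b b∈W))) ∣W∣<∣S∣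
      bound : ∀ s t → Degree≤ 1 s → Degree≤ ∣ W ∖ b ∣ t → Degree< ∣ S ∣ (s ∪ t)
      bound s t s≤1 t≤ = ≤-trans (s≤s (≤-trans (∣∪∣≤ s t) (+-mono-≤ s≤1 t≤))) ∣W∖b∣<∣S∣
    expansion : ∀ z → Everywhere z →
      det (F z) S xor mono S z
        ≡ (mono ⁅ a ⁆ z ∧ (det (F z) W xor mono W z))
            xor ((c a ∧ det (F z) W) xor expand (F z a) (det (F z)) W)
    expansion z _ =
      begin
        det (F z) S xor mono S z
      ≡⟨ cong₂ _xor_ (det-expands (F z) (F-sym z) a S a∈S) (mono-∖ S a z a∈S) ⟩
        ((F z a a ∧ det (F z) W) xor expand (F z a) (det (F z)) W) xor (lookup z a ∧ mono W z)
      ≡⟨ cong₂ (λ u x → ((u ∧ det (F z) W) xor expand (F z a) (det (F z)) W) xor (x ∧ mono W z))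
           (trans (F-diag z a) (cong (_xor c a) (sym (mono-⁅⁆ a z)))) (sym (mono-⁅⁆ a z)) ⟩
        (((mono ⁅ a ⁆ z xor c a) ∧ det (F z) W) xor expand (F z a) (det (F z)) W)
          xor (mono ⁅ a ⁆ z ∧ mono W z)
      ≡⟨ regroup (mono ⁅ a ⁆ z) (c a) (det (F z) W) (expand (F z a) (det (F z)) W) (mono W z) ⟩
        (mono ⁅ a ⁆ z ∧ (det (F z) W xor mono W z)) xor ((c a ∧ det (F z) W) xor expand (F z a) (det (F z)) W)
      ∎
      where
      open ≡-Reasoning
      regroup : ∀ x c d e m → (((x xor c) ∧ d) xor e) xor (x ∧ m) ≡ (x ∧ (d xor m)) xor ((c ∧ d) xor e)
      regroup = solve-∀ F₂-ring

  leading : ∀ S → Leading S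
  leading = size-induction Leading leading-step
    where
    leading-step : ∀ S → (∀ {T} → ∣ T ∣ < ∣ S ∣ → Leading T) → Leading S
    leading-step S IH with member-or-empty S
    ... | inj₁ (a , a∈S) = leading-at S a a∈S IH
    ... | inj₂ empty     =
      Spanned-cong (λ z _ → cong₂ _xor_ (det-empty (F z) S empty) (mono-empty S z empty)) Spanned-zero

  -- On a set Z of points at which every principal minor of size ≥ k vanishes,
  -- each monomial agrees with a polynomial of degree < k: for ∣ s ∣ ≥ k,
  -- z^s = det F(z) s + z^s on Z, and the right side has lower degree.
  reduce : (Z : Vec F₂ N → Set) (k : ℕ) → (∀ z → Z z → ∀ S → k ≤ ∣ S ∣ → det (F z) S ≡ false) →
    ∀ s → Spanned (Degree< k) Z (mono s)
  reduce Z k minors-vanish = size-induction (λ s → Spanned (Degree< k) Z (mono s)) step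
    where
    step : ∀ s → (∀ {t} → ∣ t ∣ < ∣ s ∣ → Spanned (Degree< k) Z (mono t)) → Spanned (Degree< k) Z (mono s)
    step s IH with ∣ s ∣ <? k
    ... | yes s<k = Spanned-mono {s = s} s<k
    ... | no  s≮k = Spanned-cong on-Z (Spanned-poly terms (All.map (λ {t} → IH {t}) allowed))
      where
      open Spanned (leading s)
      on-Z : ∀ z → Z z → mono s z ≡ poly terms z
      on-Z z Zz = trans (cong (_xor mono s z) (sym (minors-vanish z Zz s (≮⇒≥ s≮k)))) (agrees z _)

  low-degree-on : (Z : Vec F₂ N → Set) (k : ℕ) → (∀ z → Z z → ∀ S → k ≤ ∣ S ∣ → det (F z) S ≡ false) →
    ∀ f → Spanned (Degree< k) Z f
  low-degree-on Z k minors-vanish f =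
    Spanned-cong (λ z _ → sym (interpolate-correct f z))
      (Spanned-poly (interpolate f) (All.tabulate (λ {s} _ → reduce Z k minors-vanish s)))

-- Counting functions and coefficient vectors

unique-⊆⇒length-≤ : ∀ {A : Set} (xs ys : List A) → Unique xs → (∀ {x} → x ∈ xs → x ∈ ys) →
  length xs ≤ length ys
unique-⊆⇒length-≤ []       ys unique       xs⊆ys = z≤n
unique-⊆⇒length-≤ (x ∷ xs) ys (x∉xs ∷ unique) xs⊆ys =
  subst (suc (length xs) ≤_) (sym (length-removeAt′ ys (index x∈ys)))
    (s≤s (unique-⊆⇒length-≤ xs (ys Any.─ x∈ys) unique
            (λ y∈xs → keep ys x∈ys (xs⊆ys (there y∈xs)) (λ y≡x → All.lookup x∉xs y∈xs (sym y≡x)))))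
  where
  x∈ys = xs⊆ys (here refl)
  keep : ∀ {x y} ys (x∈ys : x ∈ ys) → y ∈ ys → y ≢ x → y ∈ (ys Any.─ x∈ys)
  keep (z ∷ ys) (here refl) (here refl) y≢x = ⊥-elim (y≢x refl)
  keep (z ∷ ys) (here refl) (there y∈)  y≢x = y∈
  keep (z ∷ ys) (there x∈)  (here refl) y≢x = here refl
  keep (z ∷ ys) (there x∈)  (there y∈)  y≢x = there (keep ys x∈ y∈ y≢x)

length-allVecs : ∀ n → length (allVecs n) ≡ 2 ^ n
length-allVecs zero    = refl
length-allVecs (suc n) =
  begin
    length (map (false ∷_) (allVecs n) ++ map (true ∷_) (allVecs n))
  ≡⟨ length-++ (map (false ∷_) (allVecs n)) ⟩
    length (map (false ∷_) (allVecs n)) + length (map (true ∷_) (allVecs n))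
  ≡⟨ cong₂ _+_ (length-map (false ∷_) (allVecs n)) (length-map (true ∷_) (allVecs n)) ⟩
    length (allVecs n) + length (allVecs n)
  ≡⟨ cong (λ m → m + m) (length-allVecs n) ⟩
    2 ^ n + 2 ^ n
  ≡⟨ cong (2 ^ n +_) (sym (+-identityʳ (2 ^ n))) ⟩
    2 ^ suc n
  ∎
  where open ≡-Reasoning

allVecs-unique : ∀ n → Unique (allVecs n)
allVecs-unique zero    = [] ∷ []
allVecs-unique (suc n) =
  Unique.++⁺ (Unique.map⁺ ∷-injectiveʳ (allVecs-unique n)) (Unique.map⁺ ∷-injectiveʳ (allVecs-unique n)) disjoint
  where
  disjoint : ∀ {v} → ¬ (v ∈ map (false ∷_) (allVecs n) × v ∈ map (true ∷_) (allVecs n))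
  disjoint (v∈₀ , v∈₁) with ∈-map⁻ (false ∷_) v∈₀ | ∈-map⁻ (true ∷_) v∈₁
  ... | _ , _ , refl | _ , _ , ()

-- A surjection F₂ᵐ → F₂ⁿ forces n ≤ m (compare 2ⁿ and 2ᵐ).
surjection⇒≤ : ∀ {m n} (Φ : Vec F₂ m → Vec F₂ n) → (∀ v → Σ (Vec F₂ m) λ c → Φ c ≡ v) → n ≤ m
surjection⇒≤ {m} {n} Φ onto =
  ≮⇒≥ (λ m<n → ≤⇒≯ (subst₂ _≤_ lengthₙ (length-allVecs m) sections-fit)
                     (^-monoʳ-< 2 (s≤s (s≤s z≤n)) m<n))
  where
  section : Vec F₂ n → Vec F₂ m
  section v = proj₁ (onto v)
  section-injective : ∀ {v w} → section v ≡ section w → v ≡ w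
  section-injective {v} {w} eq = trans (sym (proj₂ (onto v))) (trans (cong Φ eq) (proj₂ (onto w)))
  sections-fit : length (map section (allVecs n)) ≤ length (allVecs m)
  sections-fit = unique-⊆⇒length-≤ (map section (allVecs n)) (allVecs m)
                   (Unique.map⁺ section-injective (allVecs-unique n)) (λ _ → allVecs-complete _)
  lengthₙ : length (map section (allVecs n)) ≡ 2 ^ n
  lengthₙ = trans (length-map section (allVecs n)) (length-allVecs n)

valuesOn : ∀ {A B : Set} → (A → B) → (xs : List A) → Vec B (length xs)
valuesOn f []       = []
valuesOn f (x ∷ xs) = f x ∷ valuesOn f xs

valuesOn-cong : ∀ {A B : Set} {f g : A → B} xs → (∀ x → x ∈ xs → f x ≡ g x) →
  valuesOn f xs ≡ valuesOn g xs
valuesOn-cong []       f≡g = refl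
valuesOn-cong (x ∷ xs) f≡g = cong₂ _∷_ (f≡g x (here refl)) (valuesOn-cong xs (λ y y∈ → f≡g y (there y∈)))

prescribe : ∀ {n} (zs : List (Vec F₂ n)) → Unique zs → (v : Vec F₂ (length zs)) →
  Σ (Vec F₂ n → F₂) λ f → valuesOn f zs ≡ v
prescribe []       []                  []      = (λ _ → false) , refl
prescribe (z ∷ zs) (z∉zs ∷ zs-unique) (x ∷ v) =
  f , cong₂ _∷_ at-z (trans (valuesOn-cong zs (λ y y∈ → away (All.lookup z∉zs y∈))) g-values)
  where
  g = proj₁ (prescribe zs zs-unique v)
  g-values = proj₂ (prescribe zs zs-unique v)
  f : Vec F₂ _ → F₂
  f y with ≡-dec _≟_ y z
  ... | yes _ = x
  ... | no  _ = g y
  at-z : f z ≡ x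
  at-z with ≡-dec _≟_ z z
  ... | yes _   = refl
  ... | no  z≢z = ⊥-elim (z≢z refl)
  away : ∀ {y} → z ≢ y → f y ≡ g y
  away {y} z≢y with ≡-dec _≟_ y z
  ... | yes y≡z = ⊥-elim (z≢y (sym y≡z))
  ... | no  _   = refl

select : ∀ {A : Set} (xs : List A) → Vec F₂ (length xs) → List A
select []       []           = []
select (x ∷ xs) (false ∷ cs) = select xs cs
select (x ∷ xs) (true  ∷ cs) = x ∷ select xs cs

select-none : ∀ {n} (ms : List (Subset n)) z → poly (select ms (replicate (length ms) false)) z ≡ false
select-none []       z = refl
select-none (m ∷ ms) z = select-none ms z

toggle : ∀ {n} (ms : List (Subset n)) {s} → s ∈ ms → (cs : Vec F₂ (length ms)) →
  Σ (Vec F₂ (length ms)) λ cs′ → ∀ z → poly (select ms cs′) z ≡ mono s z xor poly (select ms cs) z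
toggle (m ∷ ms) (here refl) (false ∷ cs) = (true ∷ cs) , (λ z → refl)
toggle (m ∷ ms) (here refl) (true  ∷ cs) = (false ∷ cs) , (λ z → sym (xor-cancelˡ (mono m z) _))
toggle (m ∷ ms) (there s∈)  (false ∷ cs) = (false ∷ proj₁ (toggle ms s∈ cs)) , proj₂ (toggle ms s∈ cs)
toggle (m ∷ ms) {s} (there s∈) (true ∷ cs) =
  (true ∷ proj₁ (toggle ms s∈ cs)) ,
  (λ z → trans (cong (mono m z xor_) (proj₂ (toggle ms s∈ cs) z)) (exchange (mono m z) (mono s z) _))
  where
  exchange : ∀ u v w → u xor (v xor w) ≡ v xor (u xor w)
  exchange = solve-∀ F₂-ring

as-selection : ∀ {n} (ms : List (Subset n)) q → All (_∈ ms) q →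
  Σ (Vec F₂ (length ms)) λ cs → ∀ z → poly (select ms cs) z ≡ poly q z
as-selection ms []      []          = replicate (length ms) false , select-none ms
as-selection ms (s ∷ q) (s∈ ∷ q⊆ms) =
  proj₁ toggled , (λ z → trans (proj₂ toggled z) (cong (mono s z xor_) (proj₂ rest z)))
  where
  rest = as-selection ms q q⊆ms
  toggled = toggle ms s∈ (proj₁ rest)

-- If every function on the distinct points zs agrees there with a sum of
-- monomials from ms, then ∣ zs ∣ ≤ ∣ ms ∣: coefficient vectors over ms map onto
-- value vectors on zs.
dimension-bound : ∀ {n} (zs : List (Vec F₂ n)) (ms : List (Subset n)) → Unique zs →
  (∀ f → Spanned (_∈ ms) (_∈ zs) f) → length zs ≤ length ms
dimension-bound zs ms zs-unique spans = surjection⇒≤ values onto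
  where
  values : Vec F₂ (length ms) → Vec F₂ (length zs)
  values cs = valuesOn (poly (select ms cs)) zs
  onto : ∀ v → Σ (Vec F₂ (length ms)) λ cs → values cs ≡ v
  onto v = cs , trans (valuesOn-cong zs (λ z z∈ → trans (cs-poly z) (sym (agrees z z∈)))) f-values
    where
    f = proj₁ (prescribe zs zs-unique v)
    f-values = proj₂ (prescribe zs zs-unique v)
    open Spanned (spans f)
    cs = proj₁ (as-selection ms terms allowed)
    cs-poly = proj₂ (as-selection ms terms allowed)

length-filter-++ : ∀ {A : Set} {P : A → Set} (P? : Decidable P) xs ys →
  length (filter P? (xs ++ ys)) ≡ length (filter P? xs) + length (filter P? ys)
length-filter-++ P? xs ys = trans (cong length (filter-++ P? xs ys)) (length-++ (filter P? xs))

length-filter-map : ∀ {A B : Set} {P : B → Set} {Q : A → Set}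
  (P? : Decidable P) (Q? : Decidable Q) (f : A → B) → (∀ x → does (P? (f x)) ≡ does (Q? x)) →
  ∀ xs → length (filter P? (map f xs)) ≡ length (filter Q? xs)
length-filter-map P? Q? f agree []       = refl
length-filter-map P? Q? f agree (x ∷ xs) with does (P? (f x)) | does (Q? x) | agree x
... | false | .false | refl = length-filter-map P? Q? f agree xs
... | true  | .true  | refl = cong suc (length-filter-map P? Q? f agree xs)

binomials : ℕ → ℕ → ℕ
binomials n k = sum (applyUpTo (n C_) k)

sum-applyUpTo-cong : ∀ {f g : ℕ → ℕ} k → (∀ i → f i ≡ g i) → sum (applyUpTo f k) ≡ sum (applyUpTo g k)
sum-applyUpTo-cong zero    f≡g = refl
sum-applyUpTo-cong (suc k) f≡g = cong₂ _+_ (f≡g 0) (sum-applyUpTo-cong k (f≡g ∘ suc))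

sum-applyUpTo-+ : ∀ (f g : ℕ → ℕ) k →
  sum (applyUpTo (λ i → f i + g i) k) ≡ sum (applyUpTo f k) + sum (applyUpTo g k)
sum-applyUpTo-+ f g zero    = refl
sum-applyUpTo-+ f g (suc k) =
  trans (cong (f 0 + g 0 +_) (sum-applyUpTo-+ (f ∘ suc) (g ∘ suc) k))
        (interchange (f 0) (g 0) (sum (applyUpTo (f ∘ suc) k)) (sum (applyUpTo (g ∘ suc) k)))
  where
  interchange : ∀ a b c d → a + b + (c + d) ≡ a + c + (b + d)
  interchange = ℕ-solve-∀

sum-zeros : ∀ k → sum (applyUpTo (λ _ → 0) k) ≡ 0
sum-zeros zero    = refl
sum-zeros (suc k) = sum-zeros k

binomials-pascal : ∀ n k → binomials (suc n) (suc k) ≡ binomials n (suc k) + binomials n k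
binomials-pascal n k =
  begin
    1 + sum (applyUpTo (λ i → suc n C suc i) k)
  ≡⟨ cong (1 +_) (sum-applyUpTo-cong k (λ i → sym (nCk+nC[k+1]≡[n+1]C[k+1] n i))) ⟩
    1 + sum (applyUpTo (λ i → n C i + n C suc i) k)
  ≡⟨ cong (1 +_) (sum-applyUpTo-+ (n C_) (λ i → n C suc i) k) ⟩
    1 + (binomials n k + sum (applyUpTo (λ i → n C suc i) k))
  ≡⟨ cong suc (+-comm (binomials n k) _) ⟩
    binomials n (suc k) + binomials n k
  ∎
  where open ≡-Reasoning

count-by-first : ∀ n k k′ → (∀ s → does (suc ∣ s ∣ <? k) ≡ does (∣ s ∣ <? k′)) →
  length (filter (λ s → ∣ s ∣ <? k) (allVecs (suc n)))
    ≡ length (filter (λ s → ∣ s ∣ <? k) (allVecs n)) + length (filter (λ s → ∣ s ∣ <? k′) (allVecs n))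
count-by-first n k k′ shift =
  trans (length-filter-++ (λ s → ∣ s ∣ <? k) (map (false ∷_) (allVecs n)) (map (true ∷_) (allVecs n)))
        (cong₂ _+_ (length-filter-map _ (λ s → ∣ s ∣ <? k) (false ∷_) (λ _ → refl) (allVecs n))
                   (length-filter-map _ (λ s → ∣ s ∣ <? k′) (true ∷_) shift (allVecs n)))

count-small : ∀ n k → length (filter (λ s → ∣ s ∣ <? k) (allVecs n)) ≡ binomials n k
count-small zero    zero    = refl
count-small zero    (suc k) = cong suc (sym (sum-zeros k))
count-small (suc n) zero    =
  trans (count-by-first n 0 0 (λ _ → refl)) (cong₂ _+_ (count-small n 0) (count-small n 0))
count-small (suc n) (suc k) =
  trans (count-by-first n (suc k) k (λ _ → refl))
        (trans (cong₂ _+_ (count-small n (suc k)) (count-small n k)) (sym (binomials-pascal n k)))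

module AffineFamily {N} (As : Fin N → Mat N) (Cm : Mat N)
  (symA : ∀ i → Symmetric (As i)) (diagA : ∀ i k → As i k k ≡ δ i k) (symC : Symmetric Cm) where

  A+C : Vec F₂ N → Mat N
  A+C z = lincomb As z +ₘ Cm

  A+C-sym : ∀ z → Symmetric (A+C z)
  A+C-sym z i j = cong₂ _xor_ (Σ₂-cong (λ k → cong (lookup z k ∧_) (symA k i j))) (symC i j)

  A+C-affine : ∀ i j → Spanned (Degree≤ 1) Everywhere (λ z → A+C z i j)
  A+C-affine i j = Spanned-xor (Spanned-Σ₂ linear) constant
    where
    linear : ∀ k → Spanned (Degree≤ 1) Everywhere (λ z → lookup z k ∧ As k i j)
    linear k =
      Spanned-cong (λ z _ → trans (∧-comm (lookup z k) (As k i j)) (cong (As k i j ∧_) (sym (mono-⁅⁆ k z))))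
        (Spanned-when (As k i j) (λ _ → Spanned-mono {s = ⁅ k ⁆} (≤-reflexive (∣⁅x⁆∣≡1 k))))
    constant : Spanned (Degree≤ 1) Everywhere (λ _ → Cm i j)
    constant =
      Spanned-cong (λ z _ → trans (sym (∧-identityʳ (Cm i j))) (cong (Cm i j ∧_) (sym (mono-⊥ z))))
        (Spanned-when (Cm i j) (λ _ → Spanned-mono {s = ⊥} (subst (_≤ 1) (sym (∣⊥∣≡0 N)) z≤n)))

  A+C-diag : ∀ z i → A+C z i i ≡ lookup z i xor Cm i i
  A+C-diag z i = cong (_xor Cm i i) (trans (Σ₂-cong (λ k → cong (lookup z k ∧_) (diagA k i))) (Σ₂-δ z i))

  open LeadingTerm A+C (λ i → Cm i i) A+C-sym A+C-affine A+C-diag public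

  minors-vanish : ∀ k → 1 ≤ k → ∀ z → rank (A+C z) ≤ k ∸ 1 → ∀ S → k ≤ ∣ S ∣ → det (A+C z) S ≡ false
  minors-vanish (suc k) _ z low-rank S big with det (A+C z) S in det≡1
  ... | false = refl
  ... | true  = contradiction (≤-trans big (≤-trans (rank-≥ (A+C z) (A+C-sym z) S det≡1) low-rank))
                              (<-irrefl refl)

lemma4p6 : (N : ℕ) (As : Fin N → Mat N) (Cm : Mat N)
    → (∀ i → Symmetric (As i))
    → (∀ i k → As i k k ≡ δ i k)
    → Symmetric Cm
    → (k : ℕ) → 1 ≤ k → k ≤ N
    → length (filter (λ z → rank (lincomb As z +ₘ Cm) ≤? k ∸ 1) (allVecs N))
      ≤ sum (map (λ i → N C i) (upTo k))
lemma4p6 N As Cm symA diagA symC k 1≤k _ =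
  begin
    length low-rank
  ≤⟨ dimension-bound low-rank small (Unique.filter⁺ low-rank? (allVecs-unique N)) every-function-spanned ⟩
    length small
  ≡⟨ count-small N k ⟩
    binomials N k
  ≡⟨ cong sum (sym (map-upTo (N C_) k)) ⟩
    sum (map (λ i → N C i) (upTo k))
  ∎
  where
  open ≤-Reasoning
  open AffineFamily As Cm symA diagA symC
  low-rank? : (z : Vec F₂ N) → Dec (rank (A+C z) ≤ k ∸ 1)
  low-rank? z = rank (A+C z) ≤? k ∸ 1
  low-rank = filter low-rank? (allVecs N)
  small = filter (λ s → ∣ s ∣ <? k) (allVecs N)
  every-function-spanned : ∀ f → Spanned (_∈ small) (_∈ low-rank) f
  every-function-spanned f =
    Spanned-weaken (λ {s} s<k → ∈-filter⁺ (λ s → ∣ s ∣ <? k) (allVecs-complete s) s<k)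
      (Spanned-restrict (λ z z∈ → proj₂ (∈-filter⁻ low-rank? {xs = allVecs N} z∈))
        (low-degree-on (λ z → rank (A+C z) ≤ k ∸ 1) k (minors-vanish k 1≤k) f))
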